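{- Let $\Sigma=\{\mathtt{a},\mathtt{b}\}$ and for $\mathtt{x}\in\Sigma$ let $\overline{\mathtt{x}}$ denote the other letter. For every $w\in\Sigma^*$ with $\alpha$-$\beta$-factorization $w=\alpha_0\beta_1\alpha_1\cdots\beta_{\iota(w)}\alpha_{\iota(w)}$ and every $i\in\{1,\dots,\iota(w)\}$: (1) $\beta_i\in\{\mathtt{a},\mathtt{b},\mathtt{ab},\mathtt{ba}\}$; (2) if $\beta_i=\mathtt{x}$ with $\mathtt{x}\in\Sigma$, then $\alpha_{i-1},\alpha_i\in\overline{\mathtt{x}}^+$; (3) if $\beta_i=\mathtt{x}\overline{\mathtt{x}}$ with $\mathtt{x}\in\Sigma$, then $\alpha_{i-1}\in\mathtt{x}^*$ and $\alpha_i\in\overline{\mathtt{x}}^*$.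
   Context: $\iota(w)$ is the largest $\ell$ such that every word of $\Sigma^\ell$ is a scattered factor (subsequence) of $w$. The arch factorization of $w$ is the unique factorization $w=\mathrm{ar}_1(w)\cdots\mathrm{ar}_\ell(w)\mathrm{re}(w)$ where each arch contains every letter of $\Sigma$ and its last letter occurs exactly once in it, and $\mathrm{re}(w)$ does not contain every letter of $\Sigma$; $\ell=\iota(w)$. With $w^R$ the reversal, $\mathrm{ra}_i(w)\coloneqq(\mathrm{ar}_{\iota(w)-i+1}(w^R))^R$ and $\mathrm{er}(w)\coloneqq(\mathrm{re}(w^R))^R$. The $\alpha$-$\beta$-factorization is $w=\alpha_0\beta_1\alpha_1\cdots\beta_{\iota(w)}\alpha_{\iota(w)}$ with $\mathrm{ar}_i(w)=\alpha_{i-1}\beta_i$, $\mathrm{ra}_i(w)=\beta_i\alpha_i$ for $i\in\{1,\dots,\iota(w)\}$, $\alpha_0=\mathrm{er}(w)$, $\alpha_{\iota(w)}=\mathrm{re}(w)$. -}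

module Defs where

open import Data.Nat using (ℕ; zero; suc; _∸_; _+_; _≤_)
open import Data.List using (List; []; _∷_; _++_; [_]; concat; map; length; reverse; upTo)
open import Data.List.Membership.Propositional using (_∈_; _∉_)
open import Data.List.Relation.Unary.All using (All)
open import Data.Product using (Σ; _×_; ∃₂)
open import Data.Sum using (_⊎_)
open import Relation.Nullary using (¬_)
open import Relation.Binary.PropositionalEquality using (_≡_; _≢_)

data Letter : Set where
  a b : Letter

other : Letter → Letter
other a = b
other b = a

Word : Set
Word = List Letter

ContainsAll : Word → Set
ContainsAll u = ∀ (x : Letter) → x ∈ u

IsArch : Word → Set
IsArch u = ContainsAll u × ∃₂ λ (v : Word) (x : Letter) → (u ≡ v ++ [ x ]) × (x ∉ v)

-- An arch factorization w = ar₁ ⋯ ar_ℓ re (as in the paper; unique, but we do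
-- not build uniqueness into the definition).
record ArchFactorization (w : Word) : Set where
  field
    arches   : List Word
    rest     : Word
    allArch  : All IsArch arches
    restNot  : ¬ ContainsAll rest
    factors  : concat arches ++ rest ≡ w
open ArchFactorization public

-- 1-indexed lookup with default [] out of range (index 0 also gives [])
nth : List Word → ℕ → Word
nth []       _             = []
nth (u ∷ us) zero          = []
nth (u ∷ us) (suc zero)    = u
nth (u ∷ us) (suc (suc n)) = nth us (suc n)

ι : {w : Word} → ArchFactorization w → ℕ
ι F = length (arches F)

ar : {w : Word} → ArchFactorization w → ℕ → Word
ar F i = nth (arches F) i

ra : {w : Word} → ArchFactorization w → ArchFactorization (reverse w) → ℕ → Word
ra F Fr i = reverse (nth (arches Fr) (ι F ∸ i + 1))

er : (w : Word) → ArchFactorization (reverse w) → Word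
er w Fr = reverse (rest Fr)

-- α-β-factorization w = α₀ β₁ α₁ ⋯ β_ι α_ι (α, β indexed by ℕ; only
-- indices 0..ι resp. 1..ι are meaningful)
record IsAlphaBeta (w : Word) (F : ArchFactorization w)
                   (Fr : ArchFactorization (reverse w))
                   (α β : ℕ → Word) : Set where
  field
    whole : w ≡ α 0 ++ concat (map (λ i → β i ++ α i) (map suc (upTo (ι F))))
    arEq  : ∀ i → 1 ≤ i → i ≤ ι F → ar F i ≡ α (i ∸ 1) ++ β i
    raEq  : ∀ i → 1 ≤ i → i ≤ ι F → ra F Fr i ≡ β i ++ α i
    α₀Eq  : α 0 ≡ er w Fr
    αιEq  : α (ι F) ≡ rest F

Star : Letter → Word → Set
Star x u = All (_≡ x) u

Plus : Letter → Word → Set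
Plus x u = (u ≢ []) × All (_≡ x) u

-- Over a two-letter alphabet an arch is v x with v ∈ x̄⁺, since the last letter occurs only
-- once; dually a reversed arch (an arch of w read from the right) is y t with t ∈ ȳ⁺.  The
-- factor β_i is a suffix of the arch ar_i = α_{i-1} β_i and a prefix of the reversed arch
-- ra_i = β_i α_i.  It is nonempty, because every α_j misses a letter, and overlapping the
-- two shapes leaves only β_i = x with α_{i-1} = v and α_i = t, or β_i = x x̄ with both
-- neighbours unary.
module Submission where

open import Defs
open import Data.Nat using (ℕ; zero; suc; _≤_; _∸_; s≤s; z≤n)
open import Data.Nat.Properties using (≤-trans; n≤1+n)
open import Data.List using (List; []; _∷_; [_]; _++_; _∷ʳ_; reverse; length; initLast; _∷ʳ′_)
open import Data.List.Properties using (∷ʳ-injective; ++-assoc; ++-identityʳ; ++-conicalˡ; ++-conicalʳ; reverse-++; reverse-injective)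
open import Data.List.Relation.Unary.All as All using (All; []; _∷_)
open import Data.List.Relation.Unary.All.Properties using (++⁻ˡ; ++⁻ʳ)
open import Data.List.Relation.Unary.Any using (here)
open import Data.List.Relation.Unary.Any.Properties using (reverse⁻)
open import Data.List.Membership.Propositional using (_∈_)
open import Data.List.Membership.Propositional.Properties using (∈-++⁻)
open import Data.Product using (_×_; _,_; proj₁; ∃; ∃₂)
open import Data.Sum using (_⊎_; inj₁; inj₂)
open import Data.Empty using (⊥-elim)
open import Function using (_∘_)
open import Relation.Nullary using (¬_)
open import Relation.Binary.PropositionalEquality using (_≡_; _≢_; refl; sym; trans; cong; subst)

other-≢ : ∀ x → other x ≢ x
other-≢ a ()
other-≢ b ()

other-involutive : ∀ x → other (other x) ≡ x
other-involutive a = refl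
other-involutive b = refl

≢⇒≡other : ∀ {z x} → z ≢ x → z ≡ other x
≢⇒≡other {a} {a} z≢x = ⊥-elim (z≢x refl)
≢⇒≡other {a} {b} _   = refl
≢⇒≡other {b} {a} _   = refl
≢⇒≡other {b} {b} z≢x = ⊥-elim (z≢x refl)

∈⇒≢[] : ∀ {A : Set} {z : A} {u} → z ∈ u → u ≢ []
∈⇒≢[] () refl

¬ContainsAll-[] : ¬ ContainsAll []
¬ContainsAll-[] complete with complete a
... | ()

Star-incomplete : ∀ {x u} → Star x u → ¬ ContainsAll u
Star-incomplete {x} u∈x* complete = other-≢ x (All.lookup u∈x* (complete (other x)))

ContainsAll-reverse⁻ : ∀ {u} → ContainsAll (reverse u) → ContainsAll u
ContainsAll-reverse⁻ complete x = reverse⁻ (complete x)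

Plus-reverse : ∀ {x v} → Plus x v → Plus x (reverse v)
Plus-reverse (v≢[] , v∈x*) =
  v≢[] ∘ reverse-injective , All.tabulate (All.lookup v∈x* ∘ reverse⁻)

nonempty-suffix-of-∷ʳ : ∀ {A : Set} {v : List A} {x} p β → v ∷ʳ x ≡ p ++ β → β ≢ [] →
  ∃ λ β′ → β ≡ β′ ∷ʳ x × v ≡ p ++ β′
nonempty-suffix-of-∷ʳ {v = v} p β eq β≢[] with initLast β
... | [] = ⊥-elim (β≢[] refl)
... | β′ ∷ʳ′ z with v≡ , refl ← ∷ʳ-injective v (p ++ β′) (trans eq (sym (++-assoc p β′ [ z ])))
  = β′ , refl , v≡

arch-shape : ∀ {u} → IsArch u → ∃₂ λ x v → u ≡ v ∷ʳ x × Plus (other x) v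
arch-shape (complete , v , x , refl , x∉v) =
  x , v , refl , ∈⇒≢[] x̄∈v , All.tabulate (λ z∈v → ≢⇒≡other λ { refl → x∉v z∈v })
  where
  x̄∈v : other x ∈ v
  x̄∈v with ∈-++⁻ v (complete (other x))
  ... | inj₁ x̄∈v        = x̄∈v
  ... | inj₂ (here x̄≡x) = ⊥-elim (other-≢ x x̄≡x)

reverse-arch-shape : ∀ {u} → IsArch u → ∃₂ λ y t → reverse u ≡ y ∷ t × Plus (other y) t
reverse-arch-shape arch with x , v , refl , v⁺ ← arch-shape arch =
  x , reverse v , reverse-++ v [ x ] , Plus-reverse v⁺

complete-suffix⇒prefix≡[] : ∀ {y t} p {s} → Star (other y) t → y ∷ t ≡ p ++ s → ContainsAll s → p ≡ []
complete-suffix⇒prefix≡[] []      _    _    _        = refl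
complete-suffix⇒prefix≡[] (_ ∷ p) t∈ȳ* refl complete = ⊥-elim (Star-incomplete (++⁻ʳ p t∈ȳ*) complete)

nth-arch : ∀ {us} j → All IsArch us → 1 ≤ j → j ≤ length us → IsArch (nth us j)
nth-arch (suc zero)    (arch ∷ _)     _ _         = arch
nth-arch (suc (suc j)) (_ ∷ arches) _ (s≤s j≤) = nth-arch (suc j) arches (s≤s z≤n) j≤

nth-nonempty-arch : ∀ {us} j → All IsArch us → nth us j ≢ [] → IsArch (nth us j)
nth-nonempty-arch _             []           ne = ⊥-elim (ne refl)
nth-nonempty-arch zero          (_ ∷ _)      ne = ⊥-elim (ne refl)
nth-nonempty-arch (suc zero)    (arch ∷ _)   _  = arch
nth-nonempty-arch (suc (suc j)) (_ ∷ arches) ne = nth-nonempty-arch (suc j) arches ne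

data BetaShape (p : Word) : Word → Word → Set where
  single : ∀ x {s} → Plus (other x) p → Plus (other x) s → BetaShape p [ x ] s
  double : ∀ x {s} → Star x p → Star (other x) s → BetaShape p (x ∷ other x ∷ []) s

BetaShape-β : ∀ {p β s} → BetaShape p β s →
  (β ≡ [ a ]) ⊎ (β ≡ [ b ]) ⊎ (β ≡ a ∷ b ∷ []) ⊎ (β ≡ b ∷ a ∷ [])
BetaShape-β (single a _ _) = inj₁ refl
BetaShape-β (single b _ _) = inj₂ (inj₁ refl)
BetaShape-β (double a _ _) = inj₂ (inj₂ (inj₁ refl))
BetaShape-β (double b _ _) = inj₂ (inj₂ (inj₂ refl))

BetaShape-single : ∀ {p β s} → BetaShape p β s →
  ∀ x → β ≡ [ x ] → Plus (other x) p × Plus (other x) s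
BetaShape-single (single x p⁺ s⁺) .x refl = p⁺ , s⁺
BetaShape-single (double _ _ _)   _  ()

BetaShape-double : ∀ {p β s} → BetaShape p β s →
  ∀ x → β ≡ x ∷ other x ∷ [] → Star x p × Star (other x) s
BetaShape-double (single _ _ _)     _  ()
BetaShape-double (double x p∈x* s∈x̄*) .x refl = p∈x* , s∈x̄*

overlap-shape : ∀ {x y t s} p β′ → Plus (other x) (p ++ β′) → Plus (other y) t →
  y ∷ t ≡ (β′ ∷ʳ x) ++ s → BetaShape p (β′ ∷ʳ x) s
overlap-shape p [] v⁺ t⁺ refl = single _ (subst (Plus _) (++-identityʳ p) v⁺) t⁺
overlap-shape {x} p (c ∷ []) (_ , v∈x̄*) (_ , x≡c̄ ∷ s∈c̄*) refl with refl ← x≡c̄ =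
  double c (All.map (λ e → trans e (other-involutive c)) (++⁻ˡ p v∈x̄*)) s∈c̄*
overlap-shape {x} p (c ∷ d ∷ _) (_ , v∈x̄*) (_ , d≡c̄ ∷ _) refl
  with c≡x̄ ∷ d≡x̄ ∷ _ ← ++⁻ʳ p v∈x̄* =
  ⊥-elim (other-≢ x (trans (sym d≡x̄) (trans d≡c̄ (trans (cong other c≡x̄) (other-involutive x)))))

β-shape : ∀ {x v y t p β s} → Plus (other x) v → Plus (other y) t →
  v ∷ʳ x ≡ p ++ β → y ∷ t ≡ β ++ s → β ≢ [] → BetaShape p β s
β-shape {p = p} {β} v⁺ t⁺ arch reversed-arch β≢[]
  with β′ , refl , refl ← nonempty-suffix-of-∷ʳ p β arch β≢[] = overlap-shape p β′ v⁺ t⁺ reversed-arch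

module _ {w F Fr α β} (H : IsAlphaBeta w F Fr α β) where
  open IsAlphaBeta H

  ar-shape : ∀ i → 1 ≤ i → i ≤ ι F → ∃₂ λ x v → v ∷ʳ x ≡ α (i ∸ 1) ++ β i × Plus (other x) v
  ar-shape i 1≤i i≤ι with x , v , ar≡ , v⁺ ← arch-shape (nth-arch i (allArch F) 1≤i i≤ι) =
    x , v , trans (sym ar≡) (arEq i 1≤i i≤ι) , v⁺

  -- IsAlphaBeta does not tie ι(w^R) to ι F, so the arch of w^R read by ra may be the junk
  -- value [] of nth; nonemptiness rules that out.
  ra-shape : ∀ i → 1 ≤ i → i ≤ ι F → β i ++ α i ≢ [] →
    ∃₂ λ y t → y ∷ t ≡ β i ++ α i × Plus (other y) t
  ra-shape i 1≤i i≤ι ne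
    with y , t , ra≡ , t⁺ ← reverse-arch-shape
           (nth-nonempty-arch _ (allArch Fr) (ne ∘ trans (sym (raEq i 1≤i i≤ι)) ∘ cong reverse)) =
    y , t , trans (sym ra≡) (raEq i 1≤i i≤ι) , t⁺

  β-empty⇒α-complete : ∀ k → suc k ≤ ι F → β (suc k) ≡ [] → ContainsAll (α k)
  β-empty⇒α-complete k le β≡[] =
    subst ContainsAll (trans (arEq (suc k) (s≤s z≤n) le) (trans (cong (α k ++_) β≡[]) (++-identityʳ (α k))))
      (proj₁ (nth-arch (suc k) (allArch F) (s≤s z≤n) le))

  α-incomplete : ∀ j → j ≤ ι F → ¬ ContainsAll (α j)
  α-incomplete zero _ complete = restNot Fr (ContainsAll-reverse⁻ (subst ContainsAll α₀Eq complete))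
  α-incomplete (suc k) le complete =
    α-incomplete k (≤-trans (n≤1+n k) le) (β-empty⇒α-complete k le β≡[])
    where
    β≡[] : β (suc k) ≡ []
    β≡[] with _ , _ , reversed-arch , _ , t∈ȳ* ← ra-shape (suc k) (s≤s z≤n) le
                (λ e → ¬ContainsAll-[] (subst ContainsAll (++-conicalʳ (β (suc k)) _ e) complete)) =
      complete-suffix⇒prefix≡[] (β (suc k)) t∈ȳ* reversed-arch complete

  β-nonempty : ∀ i → 1 ≤ i → i ≤ ι F → β i ≢ []
  β-nonempty (suc k) _ le β≡[] =
    α-incomplete k (≤-trans (n≤1+n k) le) (β-empty⇒α-complete k le β≡[])

  αβ-shape : ∀ i → 1 ≤ i → i ≤ ι F → BetaShape (α (i ∸ 1)) (β i) (α i)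
  αβ-shape i 1≤i i≤ι
    with _ , _ , arch , v⁺ ← ar-shape i 1≤i i≤ι
       | _ , _ , reversed-arch , t⁺ ← ra-shape i 1≤i i≤ι (β-nonempty i 1≤i i≤ι ∘ ++-conicalˡ (β i) (α i))
    = β-shape v⁺ t⁺ arch reversed-arch (β-nonempty i 1≤i i≤ι)

proposition5 : (w : Word) (F : ArchFactorization w) (Fr : ArchFactorization (reverse w))
    (α β : ℕ → Word) → IsAlphaBeta w F Fr α β →
    (i : ℕ) → 1 ≤ i → i ≤ ι F →
    ((β i ≡ [ a ]) ⊎ (β i ≡ [ b ]) ⊎ (β i ≡ a ∷ b ∷ []) ⊎ (β i ≡ b ∷ a ∷ []))
    × (∀ (x : Letter) → β i ≡ [ x ] → Plus (other x) (α (i ∸ 1)) × Plus (other x) (α i))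
    × (∀ (x : Letter) → β i ≡ x ∷ other x ∷ [] → Star x (α (i ∸ 1)) × Star (other x) (α i))
proposition5 w F Fr α β H i 1≤i i≤ι =
  BetaShape-β shape , BetaShape-single shape , BetaShape-double shape
  where
  shape : BetaShape (α (i ∸ 1)) (β i) (α i)
  shape = αβ-shape H i 1≤i i≤ι
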